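{- Let $n\ge 13$, let $Q$ be a query graph on an $n$-element vertex set $V$ with minimum degree at least $n-3$, and suppose the answers $q(x,y)$ to all pairs $xy\in E(Q)$ have been received for some hidden tree on $V$. Then there are no consistent trees $T_0$, $T_1$ and distinct vertices $a,b,c,d$ such that $a,b,c,d$ lie on a path of $T_0$ in this order (not necessarily consecutively), while in $T_1$ they lie on a path in the order $b,a,d,c$ or in the order $c,a,d,b$ (not necessarily consecutively).
   Context: The answer $q(x,y)$ to a queried pair is the distance of $x$ and $y$ in the hidden tree. A tree on $V$ is consistent if for every edge $xy$ of $Q$ its distance between $x$ and $y$ equals $q(x,y)$. -}

module Defs where

open import Data.Nat using (ℕ; zero; suc; _+_; _≤_; _∸_)
open import Data.Fin using (Fin)
open import Data.Bool using (Bool; true; false; if_then_else_)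
open import Data.List using (List; []; _∷_; _++_; length; map; allFin)
open import Data.Nat.ListAction using (sum)
open import Data.Product using (Σ; ∃; _×_; _,_)
open import Relation.Binary.PropositionalEquality using (_≡_)
open import Relation.Nullary using (¬_)
open import Data.List.Relation.Unary.Unique.Propositional using (Unique)
open import Data.List.Relation.Unary.Linked using (Linked)

Graph : ℕ → Set
Graph n = Fin n → Fin n → Bool

Adj : ∀ {n} → Graph n → Fin n → Fin n → Set
Adj G x y = G x y ≡ true

IsSimple : ∀ {n} → Graph n → Set
IsSimple {n} G = (∀ (x y : Fin n) → G x y ≡ G y x) × (∀ (x : Fin n) → G x x ≡ false)

degree : ∀ {n} → Graph n → Fin n → ℕ
degree {n} G x = sum (map (λ y → if G x y then 1 else 0) (allFin n))

data Walk {n : ℕ} (G : Graph n) : Fin n → Fin n → ℕ → Set where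
  nil  : ∀ {x} → Walk G x x zero
  cons : ∀ {x y z k} → Adj G x y → Walk G y z k → Walk G x z (suc k)

Connected : ∀ {n} → Graph n → Set
Connected {n} G = ∀ (x y : Fin n) → ∃ λ k → Walk G x y k

IsPath : ∀ {n} → Graph n → List (Fin n) → Set
IsPath G vs = Unique vs × Linked (Adj G) vs

HasCycle : ∀ {n} → Graph n → Set
HasCycle {n} G = Σ (Fin n) λ v → Σ (List (Fin n)) λ ws →
  (2 ≤ length ws) × Unique (v ∷ ws) × Linked (Adj G) (v ∷ ws ++ (v ∷ []))

IsTree : ∀ {n} → Graph n → Set
IsTree G = IsSimple G × Connected G × ¬ HasCycle G

DistIs : ∀ {n} → Graph n → Fin n → Fin n → ℕ → Set
DistIs G x y k = Walk G x y k × (∀ m → Walk G x y m → k ≤ m)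

-- T is consistent with the answers q(x,y) = dist_H(x,y) for all edges xy of Q
Consistent : ∀ {n} → Graph n → Graph n → Graph n → Set
Consistent {n} Q H T = ∀ (x y : Fin n) → Adj Q x y →
  ∀ (k : ℕ) → (DistIs H x y k → DistIs T x y k) × (DistIs T x y k → DistIs H x y k)

{-# OPTIONS --safe #-}
-- Every vertex of Q misses at most three vertices, so once n ≥ 13 > 4·3 the four vertices
-- a, b, c, d have a common Q-neighbour e, and consistency forces T₀ and T₁ to agree on the
-- distances from a, b, c, d to e.  In a forest, a vertex v strictly between u and w on a path
-- is strictly closer to e than the farther of u and w: otherwise shortest walks from u and w
-- to e avoid v, and joining them closes a cycle through v.  But b and c are interior to the
-- path of T₀ and a and d are interior to the path of T₁, so none of a, b, c, d can be
-- farthest from e.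
module Submission where

open import Defs
open import Data.Bool using (Bool; true; false; if_then_else_)
open import Data.Bool.Properties using () renaming (_≟_ to _≟ᵇ_)
open import Data.Empty using (⊥-elim)
open import Data.Fin using (Fin; _≟_)
open import Data.List using (List; []; _∷_; _++_; length; map; allFin)
open import Data.List.Extrema.Nat using (max; argmax-all; ⊥≤max; xs≤max)
open import Data.List.Membership.Propositional using (_∈_)
open import Data.List.Membership.Propositional.Properties using (∈-++⁺ʳ)
open import Data.List.Properties using (length-tabulate; ++-assoc)
open import Data.List.Relation.Binary.Sublist.Heterogeneous using (_∷_; _∷ʳ_; toAny)
open import Data.List.Relation.Binary.Sublist.Heterogeneous.Properties using (take-Sublist)
open import Data.List.Relation.Binary.Sublist.Propositional using (_⊆_)
open import Data.List.Relation.Binary.Sublist.Propositional.Properties using (∷ˡ⁻)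
open import Data.List.Relation.Unary.All as All using (All; []; _∷_)
open import Data.List.Relation.Unary.All.Properties using (¬Any⇒All¬)
open import Data.List.Relation.Unary.AllPairs using ([]; _∷_)
open import Data.List.Relation.Unary.Any using (here; there)
open import Data.List.Relation.Unary.Linked as Linked using (Linked; [-]; _∷_)
open import Data.List.Relation.Unary.Unique.Propositional using (Unique)
open import Data.Nat using (ℕ; suc; _+_; _*_; _∸_; _≤_; _<_; _⊔_; z≤n; s≤s)
open import Data.Nat.Induction using (<-rec)
open import Data.Nat.ListAction using (sum)
open import Data.Nat.Properties hiding (_≟_)
open import Algebra.Properties.CommutativeSemigroup +-commutativeSemigroup using (interchange)
open import Data.Product using (Σ; ∃; ∃₂; _×_; _,_; proj₁; proj₂)
open import Data.Sum using (_⊎_; inj₁; inj₂; [_,_]′)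
open import Relation.Nullary using (¬_; yes; no)
open import Relation.Binary.PropositionalEquality

countᵇ : ∀ {a} {A : Set a} → (A → Bool) → List A → ℕ
countᵇ p xs = sum (map (λ x → if p x then 1 else 0) xs)

module _ {a} {A : Set a} where

  countᵇ≤length : ∀ (p : A → Bool) xs → countᵇ p xs ≤ length xs
  countᵇ≤length p [] = z≤n
  countᵇ≤length p (x ∷ xs) with p x
  ... | true  = s≤s (countᵇ≤length p xs)
  ... | false = m≤n⇒m≤1+n (countᵇ≤length p xs)

  countᵇ<length : ∀ (p : A → Bool) xs → ¬ All (λ x → p x ≡ true) xs → countᵇ p xs < length xs
  countᵇ<length p [] ¬all = ⊥-elim (¬all [])
  countᵇ<length p (x ∷ xs) ¬all with p x in px
  ... | true  = s≤s (countᵇ<length p xs (λ all → ¬all (px ∷ all)))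
  ... | false = s≤s (countᵇ≤length p xs)

  sum-map-+ : ∀ (f g : A → ℕ) xs → sum (map (λ x → f x + g x) xs) ≡ sum (map f xs) + sum (map g xs)
  sum-map-+ f g [] = refl
  sum-map-+ f g (x ∷ xs) = begin
    (f x + g x) + sum (map (λ x → f x + g x) xs)      ≡⟨ cong (f x + g x +_) (sum-map-+ f g xs) ⟩
    (f x + g x) + (sum (map f xs) + sum (map g xs))   ≡⟨ interchange (f x) (g x) _ _ ⟩
    (f x + sum (map f xs)) + (g x + sum (map g xs))   ∎
    where open ≡-Reasoning

  sum-map-0 : ∀ (xs : List A) → sum (map (λ _ → 0) xs) ≡ 0
  sum-map-0 []       = refl
  sum-map-0 (_ ∷ xs) = sum-map-0 xs

  length*≤sum : ∀ {c} (f : A → ℕ) xs → (∀ x → c ≤ f x) → length xs * c ≤ sum (map f xs)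
  length*≤sum f [] _ = z≤n
  length*≤sum f (x ∷ xs) c≤f = +-mono-≤ (c≤f x) (length*≤sum f xs c≤f)

  split-at : ∀ {v : A} {ws P} → (v ∷ ws) ⊆ P → ∃₂ λ pre post → P ≡ pre ++ v ∷ post × ws ⊆ post
  split-at (p ∷ʳ τ) with split-at τ
  ... | pre , post , refl , σ = p ∷ pre , post , refl , σ
  split-at (refl ∷ τ) = [] , _ , refl , τ

  split-around : ∀ {u v w : A} {P} → (u ∷ v ∷ w ∷ []) ⊆ P →
                 ∃₂ λ pre post → P ≡ pre ++ v ∷ post × u ∈ pre × w ∈ post
  split-around τ with split-at τ
  ... | pre₁ , _ , refl , σ with split-at σ
  ...   | pre₂ , post , refl , ρ =
    pre₁ ++ _ ∷ pre₂ , post , sym (++-assoc pre₁ (_ ∷ pre₂) _) , ∈-++⁺ʳ pre₁ (here refl) , toAny ρ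

  ++-disjoint : ∀ xs {ys} → Unique (xs ++ ys) → ∀ {y z : A} → y ∈ xs → z ∈ ys → y ≢ z
  ++-disjoint (x ∷ xs) (x∉ ∷ _) (here refl) z∈ys = All.lookup x∉ (∈-++⁺ʳ xs z∈ys)
  ++-disjoint (x ∷ xs) (_ ∷ uniq) (there y∈xs) z∈ys = ++-disjoint xs uniq y∈xs z∈ys

  avoids-middle : ∀ pre {v : A} {post} → Unique (pre ++ v ∷ post) → All (_≢ v) pre × All (_≢ v) post
  avoids-middle pre uniq = All.tabulate (λ z∈pre → ++-disjoint pre uniq z∈pre (here refl)) , after pre uniq
    where
    after : ∀ pre {v : A} {post} → Unique (pre ++ v ∷ post) → All (_≢ v) post
    after []        (v∉post ∷ _) = All.map ≢-sym v∉post
    after (_ ∷ pre) (_ ∷ uniq)   = after pre uniq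

-- Constructively a least witness exists only up to double negation, which suffices because
-- the theorem is a negation.
least-¬¬ : ∀ {P : ℕ → Set} {m} → P m → ¬ ¬ (∃ λ k → P k × ∀ j → P j → k ≤ j)
least-¬¬ {P} {m} = <-rec (λ m → P m → ¬ ¬ _) least-below m
  where
  least-below : ∀ m → (∀ {j} → j < m → P j → ¬ ¬ _) → P m → ¬ ¬ _
  least-below m rec pm no-least = no-least (m , pm , λ j pj → ≮⇒≥ λ j<m → rec j<m pj no-least)

distances-exist : ∀ {n} {G : Graph n} → Connected G → ∀ e xs → ¬ ¬ All (λ x → ∃ (DistIs G x e)) xs
distances-exist conn e []       k = k []
distances-exist conn e (x ∷ xs) k =
  least-¬¬ (proj₂ (conn x e)) λ dist → distances-exist conn e xs λ dists → k (dist ∷ dists)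

-- The second alternative says that each y ∈ ys is adjacent to at most length xs − 1 of the xs.
common-neighbour-or-sparse : ∀ {n} (G : Graph n) (xs ys : List (Fin n)) →
  (∃ λ y → All (λ x → Adj G x y) xs) ⊎
  (sum (map (λ x → countᵇ (G x) ys) xs) + length ys ≤ length ys * length xs)
common-neighbour-or-sparse G xs [] = inj₂ (≤-reflexive (trans (+-identityʳ _) (sum-map-0 xs)))
common-neighbour-or-sparse G xs (y ∷ ys)
  with All.all? (λ x → G x y ≟ᵇ true) xs | common-neighbour-or-sparse G xs ys
... | yes adjacent | _          = inj₁ (y , adjacent)
... | no _         | inj₁ found = inj₁ found
... | no ¬adjacent | inj₂ sparse = inj₂ (begin
  sum (map (λ x → countᵇ (G x) (y ∷ ys)) xs) + suc (length ys)
    ≡⟨ cong (_+ suc (length ys)) (sum-map-+ (λ x → if G x y then 1 else 0) (λ x → countᵇ (G x) ys) xs) ⟩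
  (hits + rest) + suc (length ys)
    ≡⟨ +-suc (hits + rest) (length ys) ⟩
  suc (hits + rest + length ys)
    ≡⟨ cong suc (+-assoc hits rest (length ys)) ⟩
  suc hits + (rest + length ys)
    ≤⟨ +-mono-≤ (countᵇ<length (λ x → G x y) xs ¬adjacent) sparse ⟩
  length xs + length ys * length xs ∎)
  where
  open ≤-Reasoning
  hits rest : ℕ
  hits = countᵇ (λ x → G x y) xs
  rest = sum (map (λ x → countᵇ (G x) ys) xs)

common-neighbour : ∀ {n} (G : Graph n) (s : ℕ) (xs : List (Fin n)) → length xs * s < n →
                   (∀ x → n ∸ s ≤ degree G x) → ∃ λ y → All (λ x → Adj G x y) xs
common-neighbour {n} G s xs ks<n δ with common-neighbour-or-sparse G xs (allFin n)
... | inj₁ found  = found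
... | inj₂ sparse = ⊥-elim (<-irrefl refl (begin-strict
  k * n                  ≤⟨ *-monoʳ-≤ k (m≤n+m∸n n s) ⟩
  k * (s + (n ∸ s))      ≡⟨ *-distribˡ-+ k s (n ∸ s) ⟩
  k * s + k * (n ∸ s)    <⟨ +-monoˡ-< (k * (n ∸ s)) ks<n ⟩
  n + k * (n ∸ s)        ≤⟨ +-monoʳ-≤ n (length*≤sum (degree G) xs δ) ⟩
  n + degrees            ≡⟨ +-comm n degrees ⟩
  degrees + n            ≤⟨ subst (λ m → degrees + m ≤ m * k) (length-tabulate (λ i → i)) sparse ⟩
  n * k                  ≡⟨ *-comm n k ⟩
  k * n                  ∎))
  where
  open ≤-Reasoning
  k degrees : ℕ
  k = length xs
  degrees = sum (map (degree G) xs)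

module Undirected {n} (G : Graph n) (G-sym : ∀ x y → G x y ≡ G y x) where

  open import Data.List.Membership.DecPropositional (_≟_ {n}) using (_∈?_)

  private
    variable
      u v w x y z e : Fin n
      ws : List (Fin n)

  adj-sym : Adj G x y → Adj G y x
  adj-sym {x} {y} xy = trans (G-sym y x) xy

  data AvoidingWalk (v : Fin n) : Fin n → Fin n → Set where
    stop : x ≢ v → AvoidingWalk v x x
    step : x ≢ v → Adj G x y → AvoidingWalk v y z → AvoidingWalk v x z

  start-avoids : AvoidingWalk v x y → x ≢ v
  start-avoids (stop x≢v)     = x≢v
  start-avoids (step x≢v _ _) = x≢v

  infixr 5 _++ᵃ_

  _++ᵃ_ : AvoidingWalk v x y → AvoidingWalk v y z → AvoidingWalk v x z
  stop _         ++ᵃ q = q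
  step x≢v xy p ++ᵃ q = step x≢v xy (p ++ᵃ q)

  reverseᵃ : AvoidingWalk v x y → AvoidingWalk v y x
  reverseᵃ (stop x≢v)      = stop x≢v
  reverseᵃ (step x≢v xy p) = reverseᵃ p ++ᵃ step (start-avoids p) (adj-sym xy) (stop x≢v)

  -- ws lists the vertices visited after x.
  data WalkVia : Fin n → List (Fin n) → Fin n → Set where
    stop : WalkVia x [] x
    step : Adj G x y → WalkVia y ws z → WalkVia x (y ∷ ws) z

  linked-via : WalkVia x ws y → Adj G y z → Linked (Adj G) (x ∷ ws ++ z ∷ [])
  linked-via stop         yz = yz ∷ [-]
  linked-via (step xy p) yz = xy ∷ linked-via p yz

  AvoidingPath : Fin n → Fin n → Fin n → Set
  AvoidingPath v x z = ∃ λ ws → WalkVia x ws z × Unique (x ∷ ws) × All (_≢ v) (x ∷ ws)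

  suffix-from : WalkVia y ws z → x ∈ y ∷ ws → Unique (y ∷ ws) → All (_≢ v) (y ∷ ws) → AvoidingPath v x z
  suffix-from p          (here refl)     uniq       avoid       = _ , p , uniq , avoid
  suffix-from (step _ p) (there x∈)      (_ ∷ uniq) (_ ∷ avoid) = suffix-from p x∈ uniq avoid

  loop-erase : AvoidingWalk v x z → AvoidingPath v x z
  loop-erase (stop x≢v) = [] , stop , [] ∷ [] , x≢v ∷ []
  loop-erase {x = x} (step x≢v xy w) with loop-erase w
  ... | ws , p , uniq , avoid with x ∈? _ ∷ ws
  ...   | yes x∈ = suffix-from p x∈ uniq avoid
  ...   | no x∉  = _ ∷ ws , step xy p , ¬Any⇒All¬ _ x∉ ∷ uniq , x≢v ∷ avoid

  cycle-through : WalkVia x ws y → Unique (x ∷ ws) → All (_≢ v) (x ∷ ws) →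
                  Adj G v x → Adj G y v → x ≢ y → HasCycle G
  cycle-through stop _ _ _ _ x≢x = ⊥-elim (x≢x refl)
  cycle-through {v = v} p@(step _ _) uniq avoid vx yv _ =
    v , _ , s≤s (s≤s z≤n) , All.map ≢-sym avoid ∷ uniq , vx ∷ linked-via p yv

  distinct-neighbours-separated : ¬ HasCycle G → Adj G v x → Adj G y v → x ≢ y → ¬ AvoidingWalk v x y
  distinct-neighbours-separated acyclic vx yv x≢y w with loop-erase w
  ... | _ , p , uniq , avoid = acyclic (cycle-through p uniq avoid vx yv x≢y)

  walk-along : Linked (Adj G) (x ∷ ws) → All (_≢ v) (x ∷ ws) → w ∈ x ∷ ws → AvoidingWalk v x w
  walk-along _             (x≢v ∷ _)     (here refl) = stop x≢v
  walk-along (xy ∷ linked) (x≢v ∷ avoid) (there w∈) = step x≢v xy (walk-along linked avoid w∈)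

  walk-to-predecessor : ∀ pre {post} → Linked (Adj G) (pre ++ v ∷ post) → All (_≢ v) pre → u ∈ pre →
                        ∃ λ y → y ∈ pre × Adj G y v × AvoidingWalk v u y
  walk-to-predecessor (p ∷ []) (pv ∷ _) (p≢v ∷ []) (here refl) = p , here refl , pv , stop p≢v
  walk-to-predecessor (p ∷ q ∷ pre) (pq ∷ linked) (p≢v ∷ avoid) (here refl)
    with walk-to-predecessor (q ∷ pre) linked avoid (here refl)
  ... | y , y∈ , yv , q⇝y = y , there y∈ , yv , step p≢v pq q⇝y
  walk-to-predecessor (p ∷ pre) linked (_ ∷ avoid) (there u∈)
    with walk-to-predecessor pre (Linked.tail linked) avoid u∈
  ... | y , y∈ , yv , u⇝y = y , there y∈ , yv , u⇝y

  walk-from-successor : ∀ pre {post} → Linked (Adj G) (pre ++ v ∷ post) → All (_≢ v) post → w ∈ post →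
                        ∃ λ x → x ∈ post × Adj G v x × AvoidingWalk v x w
  walk-from-successor [] (vx ∷ linked) avoid w∈ = _ , here refl , vx , walk-along linked avoid w∈
  walk-from-successor (_ ∷ pre) linked avoid w∈ = walk-from-successor pre (Linked.tail linked) avoid w∈

  interior-separates : ¬ HasCycle G → ∀ pre {post} → IsPath G (pre ++ v ∷ post) →
                       u ∈ pre → w ∈ post → ¬ AvoidingWalk v u w
  interior-separates acyclic pre (uniq , linked) u∈ w∈ u⇝w
    with avoids-middle pre uniq
  ... | pre-avoids , post-avoids
    with walk-to-predecessor pre linked pre-avoids u∈ | walk-from-successor pre linked post-avoids w∈
  ... | y , y∈ , yv , u⇝y | x , x∈ , vx , x⇝w =
    distinct-neighbours-separated acyclic vx yv (≢-sym (++-disjoint pre uniq y∈ (there x∈)))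
      (x⇝w ++ᵃ reverseᵃ u⇝w ++ᵃ u⇝y)

  visits-or-avoids : ∀ {k} → Walk G x y k → x ≢ v → (∃ λ i → i < k × Walk G v y i) ⊎ AvoidingWalk v x y
  visits-or-avoids nil x≢v = inj₂ (stop x≢v)
  visits-or-avoids {v = v} (cons {y = z} xz z⇝y) x≢v with z ≟ v
  ... | yes refl = inj₁ (_ , ≤-refl , z⇝y)
  ... | no z≢v with visits-or-avoids z⇝y z≢v
  ...   | inj₁ (i , i<k , v⇝y) = inj₁ (i , m<n⇒m<1+n i<k , v⇝y)
  ...   | inj₂ z⇝y′            = inj₂ (step x≢v xz z⇝y′)

  interior-closer : ¬ HasCycle G → ∀ {P du dv dw} → IsPath G P → (u ∷ v ∷ w ∷ []) ⊆ P →
                    DistIs G u e du → DistIs G v e dv → DistIs G w e dw → dv < du ⊔ dw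
  interior-closer acyclic {du = du} {dv} {dw} path uvw⊆P (u⇝e , _) (_ , dv-least) (w⇝e , _)
    with split-around uvw⊆P
  ... | pre , post , refl , u∈ , w∈
    with avoids-middle pre (proj₁ path)
  ... | pre-avoids , post-avoids
    with visits-or-avoids u⇝e (All.lookup pre-avoids u∈) | visits-or-avoids w⇝e (All.lookup post-avoids w∈)
  ... | inj₁ (i , i<du , v⇝e) | _ = <-≤-trans (≤-<-trans (dv-least i v⇝e) i<du) (m≤m⊔n du dw)
  ... | inj₂ _ | inj₁ (i , i<dw , v⇝e) = <-≤-trans (≤-<-trans (dv-least i v⇝e) i<dw) (m≤n⊔m du dw)
  ... | inj₂ u⇝e′ | inj₂ w⇝e′ = ⊥-elim (interior-separates acyclic pre path u∈ w∈ (u⇝e′ ++ᵃ reverseᵃ w⇝e′))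

-- Opaque because the library's max of a concrete list normalises to an exponentially large term.
opaque
  maximum-attained : ∀ x xs → ∃ λ m → m ∈ x ∷ xs × All (_≤ m) (x ∷ xs)
  maximum-attained x xs = max x xs , argmax-all (λ m → m) (here refl) (All.tabulate there) , ⊥≤max x xs ∷ xs≤max x xs

SameDistance : ∀ {n} → Graph n → Graph n → Fin n → Fin n → Set
SameDistance T₀ T₁ e x = ∃ λ k → DistIs T₀ x e k × DistIs T₁ x e k

incompatible-path-orders : ∀ {n} {T₀ T₁ : Graph n} {e a b c d P₀} → IsTree T₀ → IsTree T₁ →
  IsPath T₀ P₀ → (a ∷ b ∷ c ∷ d ∷ []) ⊆ P₀ →
  (Σ (List (Fin n)) λ P₁ → IsPath T₁ P₁ × ((b ∷ a ∷ d ∷ c ∷ []) ⊆ P₁)) ⊎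
  (Σ (List (Fin n)) λ P₁ → IsPath T₁ P₁ × ((c ∷ a ∷ d ∷ b ∷ []) ⊆ P₁)) →
  ¬ All (SameDistance T₀ T₁ e) (a ∷ b ∷ c ∷ d ∷ [])
incompatible-path-orders {T₀ = T₀} {T₁} ((sym₀ , _) , _ , acyclic₀) ((sym₁ , _) , _ , acyclic₁) path₀ abcd⊆P₀ order₁
  ((A , a₀ , a₁) ∷ (B , b₀ , b₁) ∷ (C , c₀ , c₁) ∷ (D , d₀ , d₁) ∷ [])
  with maximum-attained A (B ∷ C ∷ D ∷ [])
... | M , M∈ , A≤M ∷ B≤M ∷ C≤M ∷ D≤M ∷ [] = <-irrefl refl (All.lookup (proj₁ A,D<M ∷ B<M ∷ C<M ∷ proj₂ A,D<M ∷ []) M∈)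
  where
  open Undirected T₀ sym₀ using () renaming (interior-closer to closer₀)
  open Undirected T₁ sym₁ using () renaming (interior-closer to closer₁)

  below : ∀ {x y z} → x < y ⊔ z → y ≤ M → z ≤ M → x < M
  below x<y⊔z y≤M z≤M = <-≤-trans x<y⊔z (⊔-lub y≤M z≤M)

  B<M : B < M
  B<M = below (closer₀ acyclic₀ path₀ (take-Sublist 3 abcd⊆P₀) a₀ b₀ c₀) A≤M C≤M
  C<M : C < M
  C<M = below (closer₀ acyclic₀ path₀ (∷ˡ⁻ abcd⊆P₀) b₀ c₀ d₀) B≤M D≤M
  A,D<M : A < M × D < M
  A,D<M = [ (λ (_ , path₁ , badc⊆P₁) →
               below (closer₁ acyclic₁ path₁ (take-Sublist 3 badc⊆P₁) b₁ a₁ d₁) B≤M D≤M ,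
               below (closer₁ acyclic₁ path₁ (∷ˡ⁻ badc⊆P₁) a₁ d₁ c₁) A≤M C≤M)
          , (λ (_ , path₁ , cadb⊆P₁) →
               below (closer₁ acyclic₁ path₁ (take-Sublist 3 cadb⊆P₁) c₁ a₁ d₁) C≤M D≤M ,
               below (closer₁ acyclic₁ path₁ (∷ˡ⁻ cadb⊆P₁) a₁ d₁ b₁) A≤M B≤M)
          ]′ order₁

lemma2p8 : (n : ℕ) → 13 ≤ n → (Q : Graph n) → IsSimple Q →
    (∀ (x : Fin n) → n ∸ 3 ≤ degree Q x) →
    (H : Graph n) → IsTree H →
    ¬ (Σ (Graph n) λ T₀ → Σ (Graph n) λ T₁ →
         IsTree T₀ × Consistent Q H T₀ × IsTree T₁ × Consistent Q H T₁ ×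
         Σ (Fin n) λ a → Σ (Fin n) λ b → Σ (Fin n) λ c → Σ (Fin n) λ d →
         Unique (a ∷ b ∷ c ∷ d ∷ []) ×
         (Σ (List (Fin n)) λ P₀ → IsPath T₀ P₀ × ((a ∷ b ∷ c ∷ d ∷ []) ⊆ P₀)) ×
         ((Σ (List (Fin n)) λ P₁ → IsPath T₁ P₁ × ((b ∷ a ∷ d ∷ c ∷ []) ⊆ P₁)) ⊎
          (Σ (List (Fin n)) λ P₁ → IsPath T₁ P₁ × ((c ∷ a ∷ d ∷ b ∷ []) ⊆ P₁))))
lemma2p8 n 13≤n Q _ δ H _
  (T₀ , T₁ , tree₀ , consistent₀ , tree₁ , consistent₁ , a , b , c , d , _ , (_ , path₀ , abcd⊆P₀) , order₁)
  with common-neighbour Q 3 (a ∷ b ∷ c ∷ d ∷ []) 13≤n δ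
... | e , adjacent =
  distances-exist (proj₁ (proj₂ tree₀)) e _ λ dists →
  incompatible-path-orders tree₀ tree₁ path₀ abcd⊆P₀ order₁ (All.zipWith same-distance (dists , adjacent))
  where
  same-distance : ∀ {x} → ∃ (DistIs T₀ x e) × Adj Q x e → SameDistance T₀ T₁ e x
  same-distance {x} ((k , dist₀) , xe) =
    k , dist₀ , proj₁ (consistent₁ x e xe k) (proj₂ (consistent₀ x e xe k) dist₀)
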